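{- Let $k\ge2$, $N\ge1$ and $n=\lfloor \log_k(N(k-1)+1)\rfloor$. For every integer $i\ge 0$, \[f_i(N,k)-f_{i+1}(N,k)=\sum_{j=i+1}^{n-1}k^{\,j-i-1}c_j(N,k).\] Equivalently, the difference between the number of fires of a vertex on layer $i+1$ and of a vertex on layer $i+2$ equals the total number of chips, in the stable configuration, on the descendants of one fixed vertex on layer $i+1$, divided by $k$.
   Context: Fix an integer $k\ge 2$. Let $T_k$ be the infinite rooted $k$-ary tree (every vertex has exactly $k$ children) with one additional self-loop at the root, so every vertex has degree $k+1$. A vertex is on layer $i+1$ if its distance from the root is $i$ (the root is on layer 1). Chip-firing: a vertex with at least $k+1$ chips may fire, sending one chip along each incident edge (a non-root vertex sends one chip to its parent and one to each of its $k$ children; the root sends one chip to each of its $k$ children and one chip to itself along the self-loop). Starting with $N$ chips at the root and none elsewhere, vertices fire until no vertex can fire; this terminates, and the stable configuration and the number of times each vertex fires do not depend on the order of firings. All vertices on the same layer carry the same number of chips in the stable configuration and fire the same number of times. For $i\ge0$, $c_i(N,k)$ denotes the number of chips on each vertex of layer $i+1$ in the stable configuration, and $f_i(N,k)$ the number of times each vertex of layer $i+1$ fires. -}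

module Defs where

open import Data.Nat using (ℕ; zero; suc; _+_; _*_; _∸_; _^_; _≤_; _<_; s≤s; z≤n)
open import Data.Fin using (Fin; zero; suc)
import Data.Fin as F
open import Data.List using (List; []; _∷_; replicate; length)
open import Data.List.Properties using (≡-dec)
open import Relation.Nullary using (Dec; yes; no)
open import Relation.Binary.PropositionalEquality using (_≡_)

-- Vertices of the infinite rooted k-ary tree T_k: finite words over Fin k.
-- [] is the root; the children of v are (a ∷ v) for a : Fin k; the parent
-- of (a ∷ v) is v.  A vertex v lies on layer (length v + 1).
Vertex : ℕ → Set
Vertex k = List (Fin k)

_≟v_ : ∀ {k} → (u v : Vertex k) → Dec (u ≡ v)
_≟v_ = ≡-dec F._≟_

⟦_⟧ : ∀ {P : Set} → Dec P → ℕ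
⟦ yes _ ⟧ = 1
⟦ no _ ⟧ = 0

isChild : ∀ {k} → Vertex k → Vertex k → ℕ
isChild []      v = 0
isChild (_ ∷ u) v = ⟦ u ≟v v ⟧

selfLoop : ∀ {k} → Vertex k → Vertex k → ℕ
selfLoop []      []      = 1
selfLoop []      (_ ∷ _) = 0
selfLoop (_ ∷ _) _       = 0

-- number of chips that vertex u receives when vertex v fires
-- (one per edge from v to u, counting the self-loop at the root)
recv : ∀ {k} → Vertex k → Vertex k → ℕ
recv v u = isChild u v + isChild v u + selfLoop v u

Config : ℕ → Set
Config k = Vertex k → ℕ

-- firing v: v loses k+1 chips (its degree), each neighbour gets one chip per edge
fire : ∀ k → Config k → Vertex k → Config k
fire k σ v u = (σ u + recv v u) ∸ (⟦ u ≟v v ⟧ * suc k)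

initial : ∀ k → ℕ → Config k
initial k N []      = N
initial k N (_ ∷ _) = 0

data Fires (k : ℕ) : Config k → List (Vertex k) → Config k → Set where
  done : ∀ {σ} → Fires k σ [] σ
  step : ∀ {σ vs τ} (v : Vertex k) → suc k ≤ σ v →
         Fires k (fire k σ v) vs τ → Fires k σ (v ∷ vs) τ

Stable : ∀ k → Config k → Set
Stable k σ = ∀ (v : Vertex k) → σ v < suc k

fireCount : ∀ {k} → List (Vertex k) → Vertex k → ℕ
fireCount []       v = 0
fireCount (u ∷ us) v = ⟦ u ≟v v ⟧ + fireCount us v

fin0 : ∀ {k} → 2 ≤ k → Fin k
fin0 (s≤s (s≤s _)) = zero

-- a fixed vertex at distance i from the root (i.e. on layer i+1)
layerVertex : ∀ {k} → 2 ≤ k → ℕ → Vertex k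
layerVertex h i = replicate i (fin0 h)

rangeSum : (ℕ → ℕ) → ℕ → ℕ → ℕ
rangeSum f a zero    = 0
rangeSum f a (suc l) = f a + rangeSum f (suc a) l

-- c_j(N,k) = chips on the layer-(j+1) vertex in the stable configuration σ
-- f_i(N,k) = fireCount vs (layerVertex h i)
-- layerSum = Σ_{j=i+1}^{n-1} k^(j-i-1) c_j
layerSum : ∀ {k} → 2 ≤ k → Config k → ℕ → ℕ → ℕ
layerSum {k} h σ i n =
  rangeSum (λ j → k ^ (j ∸ suc i) * σ (layerVertex h j)) (suc i) (n ∸ suc i)

{-# OPTIONS --safe #-}
-- By the least action principle a legal firing sequence fires every vertex at most as
-- often as any firing vector after which no vertex holds more than k chips.  Hence the
-- firing counts f and the stable configuration c are invariant under the automorphisms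
-- of the tree that permute the children at every depth, i.e. they only depend on the
-- layer.  Chip conservation on layer d then reads
--   c_d + (k+1) f_d = [d = 0] N + f_{d-1} + k f_{d+1}      (f_{-1} := f_0, the self-loop),
-- so the net flow a_{d+1} = f_d - f_{d+1} along an edge satisfies a_d = c_d + k a_{d+1}
-- with a_0 = N.  Unrolling gives f_i - f_{i+1} = Σ_{j>i} k^{j-i-1} c_j as long as the
-- c_j vanish from some point on.  They vanish from n on: a layer without chips is never
-- fired (un-firing it together with all layers above it would still leave a stable
-- configuration, contradicting least action), so the occupied layers are 0, ..., m, and
-- then N ≥ 1 + k + ... + k^m forces m < n.
module Submission where

open import Defs
open import Data.Nat using (ℕ; zero; suc; _+_; _*_; _∸_; _^_; _≤_; _<_; z≤n; s≤s; z<s; NonZero; >-nonZero)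
open import Data.Nat.Properties
open import Data.Nat.Tactic.RingSolver using (solve-∀)
open import Data.Fin using (Fin)
import Data.Fin as Fin
import Data.Fin.Properties as Finₚ
open import Data.Fin.Permutation using (Permutation′; _⟨$⟩ʳ_; _≈_; id; flip; transpose; inverseˡ)
open import Data.List using (List; []; _∷_; length; replicate; map)
open import Data.Nat.ListAction using () renaming (sum to listSum)
open import Data.List.Properties using (length-replicate)
open import Data.Sum using (inj₁; inj₂)
open import Function using (_∘_)
open import Relation.Nullary using (Dec; yes; no; ¬_; contradiction)
open import Relation.Nullary.Decidable using (dec-true)
open import Relation.Binary.PropositionalEquality
open import Algebra.Properties.CommutativeSemigroup +-commutativeSemigroup using (interchange; xy∙z≈xz∙y)
open import Algebra.Properties.CommutativeMonoid.Sum +-0-commutativeMonoid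
  using (sum; sum-cong-≗; sum-replicate-zero; ∑-distrib-+; sum-permute)

⟦⟧-yes : ∀ {P : Set} (d : Dec P) → P → ⟦ d ⟧ ≡ 1
⟦⟧-yes (yes _) _ = refl
⟦⟧-yes (no ¬p) p = contradiction p ¬p

⟦⟧-no : ∀ {P : Set} (d : Dec P) → ¬ P → ⟦ d ⟧ ≡ 0
⟦⟧-no (yes p) ¬p = contradiction p ¬p
⟦⟧-no (no _)  _  = refl

⟦⟧-cong : ∀ {P Q : Set} (d : Dec P) (e : Dec Q) → (P → Q) → (Q → P) → ⟦ d ⟧ ≡ ⟦ e ⟧
⟦⟧-cong d (yes q) _ Q→P = ⟦⟧-yes d (Q→P q)
⟦⟧-cong d (no ¬q) P→Q _ = ⟦⟧-no d (¬q ∘ P→Q)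

sum-const : ∀ m c → sum {m} (λ _ → c) ≡ m * c
sum-const zero    c = refl
sum-const (suc m) c = cong (c +_) (sum-const m c)

sum-⟦≟⟧ : ∀ {m} (a : Fin m) → sum (λ b → ⟦ a Fin.≟ b ⟧) ≡ 1
sum-⟦≟⟧ {suc m} Fin.zero    = cong suc (sum-replicate-zero m)
sum-⟦≟⟧ {suc m} (Fin.suc a) = trans
  (sum-cong-≗ (λ b → ⟦⟧-cong (Fin.suc a Fin.≟ Fin.suc b) (a Fin.≟ b) Finₚ.suc-injective (cong Fin.suc)))
  (sum-⟦≟⟧ a)

rangeSum-cong : ∀ {f g : ℕ → ℕ} a L → (∀ j → a ≤ j → f j ≡ g j) → rangeSum f a L ≡ rangeSum g a L
rangeSum-cong a zero    _   = refl
rangeSum-cong a (suc L) f≡g =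
  cong₂ _+_ (f≡g a ≤-refl) (rangeSum-cong (suc a) L (λ j a<j → f≡g j (≤-trans (n≤1+n a) a<j)))

rangeSum-*ˡ : ∀ c (f : ℕ → ℕ) a L → rangeSum (λ j → c * f j) a L ≡ c * rangeSum f a L
rangeSum-*ˡ c f a zero    = sym (*-zeroʳ c)
rangeSum-*ˡ c f a (suc L) =
  trans (cong (c * f a +_) (rangeSum-*ˡ c f (suc a) L)) (sym (*-distribˡ-+ c (f a) _))

a+[b+c]*m≡a+c*m+b*m : ∀ a b c m → a + (b + c) * m ≡ a + c * m + b * m
a+[b+c]*m≡a+c*m+b*m = solve-∀

net-flow : ∀ k c s p q b → c + (b + q) * suc k ≡ s + (b + q + p + k * b) → s + p ≡ c + k * q
net-flow k c s p q b bal =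
  +-cancelʳ-≡ (b + q + k * b) _ _ (trans (regroupˡ s p b q k) (trans (sym bal) (regroupʳ c b q k)))
  where
  regroupˡ : ∀ s p b q k → s + p + (b + q + k * b) ≡ s + (b + q + p + k * b)
  regroupˡ = solve-∀
  regroupʳ : ∀ c b q k → c + (b + q) * suc k ≡ c + k * q + (b + q + k * b)
  regroupʳ = solve-∀

digit-step : ∀ k c y → 1 ≤ c → k * (y * (k ∸ 1) + 1) ≤ (c + k * y) * (k ∸ 1) + 1
digit-step zero    _       _ _ = z≤n
digit-step (suc K) (suc c) y _ = ≤-trans (m≤m+n _ (c * K)) (≤-reflexive (regroup K c y))
  where
  regroup : ∀ K c y → suc K * (y * K + 1) + c * K ≡ (suc c + suc K * y) * K + 1
  regroup = solve-∀

module Radix (k : ℕ) (A C : ℕ → ℕ) (A-rec : ∀ d → A d ≡ C d + k * A (suc d))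
             (M : ℕ) (A-finite : ∀ d → M ≤ d → A d ≡ 0) where

  A-vanishes : ∀ a → (∀ j → a ≤ j → C j ≡ 0) → A a ≡ 0
  A-vanishes a = vanishes M a (m≤n+m M a)
    where
    vanishes : ∀ t a → M ≤ a + t → (∀ j → a ≤ j → C j ≡ 0) → A a ≡ 0
    vanishes zero    a M≤a C≡0 = A-finite a (subst (M ≤_) (+-identityʳ a) M≤a)
    vanishes (suc t) a M≤a C≡0 = begin
        A a                 ≡⟨ A-rec a ⟩
        C a + k * A (suc a) ≡⟨ cong₂ (λ x y → x + k * y) (C≡0 a ≤-refl) (vanishes t (suc a) M≤a′ C≡0′) ⟩
        k * 0               ≡⟨ *-zeroʳ k ⟩
        0                   ∎
      where
      open ≡-Reasoning
      M≤a′ : M ≤ suc a + t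
      M≤a′ = subst (M ≤_) (+-suc a t) M≤a
      C≡0′ : ∀ j → suc a ≤ j → C j ≡ 0
      C≡0′ j a<j = C≡0 j (≤-trans (n≤1+n a) a<j)

  expansion : ∀ L a → (∀ j → a + L ≤ j → C j ≡ 0) → A a ≡ rangeSum (λ j → k ^ (j ∸ a) * C j) a L
  expansion zero    a C≡0 = A-vanishes a (λ j a≤j → C≡0 j (subst (_≤ j) (sym (+-identityʳ a)) a≤j))
  expansion (suc L) a C≡0 = begin
      A a
    ≡⟨ A-rec a ⟩
      C a + k * A (suc a)
    ≡⟨ cong₂ (λ x y → x + k * y) (sym digit) (expansion L (suc a) C≡0′) ⟩
      k ^ (a ∸ a) * C a + k * rangeSum (λ j → k ^ (j ∸ suc a) * C j) (suc a) L
    ≡⟨ cong (k ^ (a ∸ a) * C a +_) (rangeSum-*ˡ k _ (suc a) L) ⟨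
      k ^ (a ∸ a) * C a + rangeSum (λ j → k * (k ^ (j ∸ suc a) * C j)) (suc a) L
    ≡⟨ cong (k ^ (a ∸ a) * C a +_) (rangeSum-cong (suc a) L shift) ⟩
      k ^ (a ∸ a) * C a + rangeSum (λ j → k ^ (j ∸ a) * C j) (suc a) L
    ∎
    where
    open ≡-Reasoning
    C≡0′ : ∀ j → suc a + L ≤ j → C j ≡ 0
    C≡0′ j le = C≡0 j (subst (_≤ j) (sym (+-suc a L)) le)
    digit : k ^ (a ∸ a) * C a ≡ C a
    digit = trans (cong (λ e → k ^ e * C a) (n∸n≡0 a)) (*-identityˡ (C a))
    shift : ∀ j → suc a ≤ j → k * (k ^ (j ∸ suc a) * C j) ≡ k ^ (j ∸ a) * C j
    shift (suc j) (s≤s a≤j) =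
      trans (sym (*-assoc k _ (C (suc j)))) (cong (λ e → k ^ e * C (suc j)) (sym (+-∸-assoc 1 a≤j)))

  power-≤ : ∀ t a → (∀ j → j < t → 1 ≤ C (a + j)) → k ^ t ≤ A a * (k ∸ 1) + 1
  power-≤ zero    a _        = m≤n+m 1 _
  power-≤ (suc t) a occupied = begin
      k * k ^ t                             ≤⟨ *-monoʳ-≤ k (power-≤ t (suc a) occupied′) ⟩
      k * (A (suc a) * (k ∸ 1) + 1)         ≤⟨ digit-step k (C a) (A (suc a)) Ca≥1 ⟩
      (C a + k * A (suc a)) * (k ∸ 1) + 1   ≡⟨ cong (λ x → x * (k ∸ 1) + 1) (A-rec a) ⟨
      A a * (k ∸ 1) + 1                     ∎
    where
    open ≤-Reasoning
    Ca≥1 : 1 ≤ C a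
    Ca≥1 = subst (λ x → 1 ≤ C x) (+-identityʳ a) (occupied 0 z<s)
    occupied′ : ∀ j → j < t → 1 ≤ C (suc a + j)
    occupied′ j j<t = subst (λ x → 1 ≤ C x) (+-suc a j) (occupied (suc j) (s≤s j<t))

transpose-source : ∀ {k} (a z : Fin k) → transpose a z ⟨$⟩ʳ a ≡ z
transpose-source a z rewrite dec-true (a Fin.≟ a) refl = refl

module _ {k : ℕ} where

  δ : Vertex k → Vertex k → ℕ
  δ v w = ⟦ v ≟v w ⟧

  δ-sym : ∀ (v w : Vertex k) → δ v w ≡ δ w v
  δ-sym v w = ⟦⟧-cong (v ≟v w) (w ≟v v) sym sym

  -- The self-loop makes the root its own parent.
  atParent : (Vertex k → ℕ) → Vertex k → ℕ
  atParent g []      = g []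
  atParent g (_ ∷ u) = g u

  childSum : (Vertex k → ℕ) → Vertex k → ℕ
  childSum g u = sum (λ b → g (b ∷ u))

  -- Chips received by u when every vertex w fires g w times.
  inflow : (Vertex k → ℕ) → Vertex k → ℕ
  inflow g u = atParent g u + childSum g u

  inflow-cong : ∀ {f g : Vertex k → ℕ} → f ≗ g → ∀ u → inflow f u ≡ inflow g u
  inflow-cong f≗g []      = cong₂ _+_ (f≗g []) (sum-cong-≗ (λ b → f≗g (b ∷ [])))
  inflow-cong f≗g (a ∷ u) = cong₂ _+_ (f≗g u) (sum-cong-≗ (λ b → f≗g (b ∷ a ∷ u)))

  inflow-+ : ∀ (f g : Vertex k → ℕ) u → inflow (λ w → f w + g w) u ≡ inflow f u + inflow g u
  inflow-+ f g u = trans (cong₂ _+_ (atParent-+ u) (∑-distrib-+ (λ b → f (b ∷ u)) (λ b → g (b ∷ u))))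
                   (interchange (atParent f u) (atParent g u) (childSum f u) (childSum g u))
    where
    atParent-+ : ∀ u → atParent (λ w → f w + g w) u ≡ atParent f u + atParent g u
    atParent-+ []      = refl
    atParent-+ (_ ∷ _) = refl

  inflow-layered : ∀ (E : ℕ → ℕ) u → inflow (E ∘ length) u ≡ E (length u ∸ 1) + k * E (suc (length u))
  inflow-layered E []      = cong (E 0 +_) (sum-const k (E 1))
  inflow-layered E (_ ∷ u) = cong (E (length u) +_) (sum-const k _)

  inflow-δ : ∀ v u → inflow (δ v) u ≡ recv v u
  inflow-δ v u = trans (cong₂ _+_ (atParent-δ v u) (childSum-δ v u))
                       (xy∙z≈xz∙y (isChild u v) (selfLoop v u) (isChild v u))
    where
    atParent-δ : ∀ v u → atParent (δ v) u ≡ isChild u v + selfLoop v u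
    atParent-δ []      []      = refl
    atParent-δ (_ ∷ _) []      = refl
    atParent-δ []      (a ∷ u) = trans (δ-sym [] u) (sym (+-identityʳ _))
    atParent-δ (c ∷ v) (a ∷ u) = trans (δ-sym (c ∷ v) u) (sym (+-identityʳ _))

    childSum-δ : ∀ v u → childSum (δ v) u ≡ isChild v u
    childSum-δ []      u = sum-replicate-zero k
    childSum-δ (c ∷ v) u = parent? (v ≟v u)
      where
      parent? : (d : Dec (v ≡ u)) → childSum (δ (c ∷ v)) u ≡ ⟦ d ⟧
      parent? (yes refl) = trans (sum-cong-≗ (λ b → ⟦⟧-cong ((c ∷ v) ≟v (b ∷ v)) (c Fin.≟ b)
                                   (λ { refl → refl }) (cong (_∷ v))))
                                 (sum-⟦≟⟧ c)
      parent? (no v≢u)   = trans (sum-cong-≗ (λ b → ⟦⟧-no ((c ∷ v) ≟v (b ∷ u)) (λ { refl → v≢u refl })))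
                                 (sum-replicate-zero k)

  fire-inflow : ∀ σ v g u → suc k ≤ σ v →
                fire k σ v u + inflow g u + δ v u * suc k ≡ σ u + inflow (λ w → δ v w + g w) u
  fire-inflow σ v g u σv>k = begin
      fire k σ v u + inflow g u + δ v u * suc k
    ≡⟨ xy∙z≈xz∙y (fire k σ v u) (inflow g u) (δ v u * suc k) ⟩
      fire k σ v u + δ v u * suc k + inflow g u
    ≡⟨ cong (λ x → fire k σ v u + x * suc k + inflow g u) (δ-sym v u) ⟩
      fire k σ v u + ⟦ u ≟v v ⟧ * suc k + inflow g u
    ≡⟨ cong (_+ inflow g u) (refire (u ≟v v)) ⟩
      σ u + recv v u + inflow g u
    ≡⟨ +-assoc (σ u) _ _ ⟩
      σ u + (recv v u + inflow g u)
    ≡⟨ cong (λ x → σ u + (x + inflow g u)) (sym (inflow-δ v u)) ⟩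
      σ u + (inflow (δ v) u + inflow g u)
    ≡⟨ cong (σ u +_) (sym (inflow-+ (δ v) g u)) ⟩
      σ u + inflow (λ w → δ v w + g w) u
    ∎
    where
    open ≡-Reasoning
    refire : (d : Dec (u ≡ v)) → (σ u + recv v u) ∸ ⟦ d ⟧ * suc k + ⟦ d ⟧ * suc k ≡ σ u + recv v u
    refire (yes refl) = m∸n+n≡m (≤-trans (≤-reflexive (*-identityˡ (suc k))) (≤-trans σv>k (m≤m+n _ _)))
    refire (no _)     = +-identityʳ _

  conservation : ∀ {σ vs τ} → Fires k σ vs τ → ∀ u → τ u + fireCount vs u * suc k ≡ σ u + inflow (fireCount vs) u
  conservation {σ} done u = cong (σ u +_) (sym (inflow-zero u))
    where
    inflow-zero : ∀ u → inflow (λ _ → 0) u ≡ 0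
    inflow-zero []      = sum-replicate-zero k
    inflow-zero (_ ∷ _) = sum-replicate-zero k
  conservation {σ} {v ∷ vs} {τ} (step v σv>k fires) u = begin
      τ u + (δ v u + f u) * suc k
    ≡⟨ a+[b+c]*m≡a+c*m+b*m (τ u) (δ v u) (f u) (suc k) ⟩
      τ u + f u * suc k + δ v u * suc k
    ≡⟨ cong (_+ δ v u * suc k) (conservation fires u) ⟩
      fire k σ v u + inflow f u + δ v u * suc k
    ≡⟨ fire-inflow σ v f u σv>k ⟩
      σ u + inflow (λ w → δ v w + f w) u
    ∎
    where
    open ≡-Reasoning
    f : Vertex k → ℕ
    f = fireCount vs

  Stabilizing : Config k → (Vertex k → ℕ) → Set
  Stabilizing σ g = ∀ u → σ u + inflow g u ≤ k + g u * suc k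

  Stabilizing⇒fires-unstable : ∀ {σ g v} → Stabilizing σ g → suc k ≤ σ v → 1 ≤ g v
  Stabilizing⇒fires-unstable {σ} {g} {v} stab σv>k = n≢0⇒n>0 λ gv≡0 → 1+n≰n (begin
      suc k                 ≤⟨ σv>k ⟩
      σ v                   ≤⟨ m≤m+n _ _ ⟩
      σ v + inflow g v      ≤⟨ stab v ⟩
      k + g v * suc k       ≡⟨ cong (λ x → k + x * suc k) gv≡0 ⟩
      k + 0                 ≡⟨ +-identityʳ k ⟩
      k                     ∎)
    where open ≤-Reasoning

  Stabilizing-fire : ∀ {σ v g g′} → suc k ≤ σ v → g ≗ (λ w → δ v w + g′ w) →
                     Stabilizing σ g → Stabilizing (fire k σ v) g′
  Stabilizing-fire {σ} {v} {g} {g′} σv>k g≗ stab u = +-cancelʳ-≤ (δ v u * suc k) _ _ (begin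
      fire k σ v u + inflow g′ u + δ v u * suc k   ≡⟨ fire-inflow σ v g′ u σv>k ⟩
      σ u + inflow (λ w → δ v w + g′ w) u          ≡⟨ cong (σ u +_) (inflow-cong g≗ u) ⟨
      σ u + inflow g u                             ≤⟨ stab u ⟩
      k + g u * suc k                              ≡⟨ cong (λ x → k + x * suc k) (g≗ u) ⟩
      k + (δ v u + g′ u) * suc k                   ≡⟨ a+[b+c]*m≡a+c*m+b*m k (δ v u) (g′ u) (suc k) ⟩
      k + g′ u * suc k + δ v u * suc k             ∎)
    where open ≤-Reasoning

  leastAction : ∀ {σ vs τ g} → Fires k σ vs τ → Stabilizing σ g → ∀ u → fireCount vs u ≤ g u
  leastAction done _ _ = z≤n
  leastAction {σ} {v ∷ vs} {g = g} (step v σv>k fires) stab u = begin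
      δ v u + fireCount vs u  ≤⟨ +-monoʳ-≤ (δ v u) (leastAction fires (Stabilizing-fire {σ} σv>k g≗ stab) u) ⟩
      δ v u + g′ u            ≡⟨ g≗ u ⟨
      g u                     ∎
    where
    open ≤-Reasoning
    g′ : Vertex k → ℕ
    g′ w = g w ∸ δ v w
    δ≤g : ∀ w (d : Dec (v ≡ w)) → ⟦ d ⟧ ≤ g w
    δ≤g _ (yes refl) = Stabilizing⇒fires-unstable {σ} stab σv>k
    δ≤g _ (no _)     = z≤n
    g≗ : g ≗ (λ w → δ v w + g′ w)
    g≗ w = sym (m+[n∸m]≡n (δ≤g w (v ≟v w)))

  -- Otherwise the firing vector minus e would be a smaller stabilizing vector.
  stable-unfiring⇒zero : ∀ {σ vs τ e} → Fires k σ vs τ → (∀ u → e u ≤ fireCount vs u) →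
                         (∀ u → τ u + e u * suc k ≤ k + inflow e u) → ∀ u → e u ≡ 0
  stable-unfiring⇒zero {σ} {vs} {τ} {e} fires e≤f unfired u =
    m+n≤n⇒m≡0 (≤-trans (≤-reflexive (f≗ u)) (leastAction fires stab u))
    where
    f : Vertex k → ℕ
    f = fireCount vs
    g : Vertex k → ℕ
    g w = f w ∸ e w
    f≗ : ∀ w → e w + g w ≡ f w
    f≗ w = m+[n∸m]≡n (e≤f w)
    m+n≤n⇒m≡0 : ∀ {m n} → m + n ≤ n → m ≡ 0
    m+n≤n⇒m≡0 {m} {n} le = n≤0⇒n≡0 (+-cancelʳ-≤ n m 0 le)
    stab : Stabilizing σ g
    stab w = +-cancelʳ-≤ (inflow e w) _ _ (begin
        σ w + inflow g w + inflow e w     ≡⟨ +-assoc (σ w) _ _ ⟩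
        σ w + (inflow g w + inflow e w)   ≡⟨ cong (σ w +_) (trans (+-comm (inflow g w) (inflow e w)) (sym (inflow-+ e g w))) ⟩
        σ w + inflow (λ x → e x + g x) w  ≡⟨ cong (σ w +_) (inflow-cong f≗ w) ⟩
        σ w + inflow f w                  ≡⟨ conservation fires w ⟨
        τ w + f w * suc k                 ≡⟨ cong (λ x → τ w + x * suc k) (f≗ w) ⟨
        τ w + (e w + g w) * suc k         ≡⟨ trans (cong (τ w +_) (*-distribʳ-+ (suc k) (e w) (g w))) (sym (+-assoc (τ w) _ _)) ⟩
        τ w + e w * suc k + g w * suc k   ≤⟨ +-monoˡ-≤ _ (unfired w) ⟩
        k + inflow e w + g w * suc k      ≡⟨ xy∙z≈xz∙y k _ _ ⟩
        k + g w * suc k + inflow e w      ∎)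
      where open ≤-Reasoning

  fireCount-deep : ∀ (vs : List (Vertex k)) u → listSum (map length vs) < length u → fireCount vs u ≡ 0
  fireCount-deep []       u _    = refl
  fireCount-deep (v ∷ vs) u deep = cong₂ _+_
    (⟦⟧-no (v ≟v u) (λ { refl → <⇒≱ deep (m≤m+n _ _) }))
    (fireCount-deep vs u (≤-<-trans (m≤n+m _ (length v)) deep))

  relabel : (ℕ → Permutation′ k) → Vertex k → Vertex k
  relabel π []      = []
  relabel π (b ∷ v) = (π (length v) ⟨$⟩ʳ b) ∷ relabel π v

  length-relabel : ∀ π v → length (relabel π v) ≡ length v
  length-relabel π []      = refl
  length-relabel π (b ∷ v) = cong suc (length-relabel π v)

  relabel-inverse : ∀ π v → relabel (flip ∘ π) (relabel π v) ≡ v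
  relabel-inverse π []      = refl
  relabel-inverse π (b ∷ v) rewrite length-relabel π v | relabel-inverse π v =
    cong (_∷ v) (inverseˡ (π (length v)))

  relabel-local : ∀ π ρ u → (∀ d → d < length u → π d ≈ ρ d) → relabel π u ≡ relabel ρ u
  relabel-local π ρ []      _     = refl
  relabel-local π ρ (b ∷ u) π≈ρ =
    cong₂ _∷_ (π≈ρ (length u) ≤-refl b) (relabel-local π ρ u (λ d d< → π≈ρ d (m<n⇒m<1+n d<)))

  inflow-relabel : ∀ π (f : Vertex k → ℕ) u → inflow (f ∘ relabel π) u ≡ inflow f (relabel π u)
  inflow-relabel π f u =
    cong₂ _+_ (atParent-relabel u) (sym (sum-permute (λ b → f (b ∷ relabel π u)) (π (length u))))
    where
    atParent-relabel : ∀ u → atParent (f ∘ relabel π) u ≡ atParent f (relabel π u)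
    atParent-relabel []      = refl
    atParent-relabel (_ ∷ _) = refl

  initial-relabel : ∀ N π u → initial k N (relabel π u) ≡ initial k N u
  initial-relabel N π []      = refl
  initial-relabel N π (_ ∷ _) = refl

  canonical : Fin k → Vertex k → ℕ → Permutation′ k
  canonical z []      d = id
  canonical z (a ∷ u) d with d ≟ length u
  ... | yes _ = transpose a z
  ... | no  _ = canonical z u d

  relabel-canonical : ∀ z u → relabel (canonical z u) u ≡ replicate (length u) z
  relabel-canonical z []      = refl
  relabel-canonical z (a ∷ u) = cong₂ _∷_ top (trans (relabel-local _ _ u below) (relabel-canonical z u))
    where
    top : canonical z (a ∷ u) (length u) ⟨$⟩ʳ a ≡ z
    top with length u ≟ length u
    ... | yes _ = transpose-source a z
    ... | no ≢  = contradiction refl ≢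
    below : ∀ d → d < length u → canonical z (a ∷ u) d ≈ canonical z u d
    below d d< b with d ≟ length u
    ... | yes refl = contradiction d< (<-irrefl refl)
    ... | no _     = refl

  relabel-invariant⇒layered : ∀ (h : Vertex k → ℕ) z → (∀ π u → h (relabel π u) ≡ h u) →
                              ∀ u → h u ≡ h (replicate (length u) z)
  relabel-invariant⇒layered h z inv u =
    trans (sym (inv (canonical z u) u)) (cong h (relabel-canonical z u))

  module _ {N vs τ} (fires : Fires k (initial k N) vs τ) (stable : Stable k τ) where

    fireCount-relabel-≤ : ∀ π u → fireCount vs u ≤ fireCount vs (relabel π u)
    fireCount-relabel-≤ π = leastAction fires stab
      where
      open ≤-Reasoning
      f : Vertex k → ℕ
      f = fireCount vs
      stab : Stabilizing (initial k N) (f ∘ relabel π)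
      stab u = begin
          initial k N u + inflow (f ∘ relabel π) u
        ≡⟨ cong₂ _+_ (sym (initial-relabel N π u)) (inflow-relabel π f u) ⟩
          initial k N (relabel π u) + inflow f (relabel π u)
        ≡⟨ conservation fires (relabel π u) ⟨
          τ (relabel π u) + f (relabel π u) * suc k
        ≤⟨ +-monoˡ-≤ _ (≤-pred (stable (relabel π u))) ⟩
          k + f (relabel π u) * suc k
        ∎

    fireCount-relabel : ∀ π u → fireCount vs (relabel π u) ≡ fireCount vs u
    fireCount-relabel π u = ≤-antisym
      (subst (fireCount vs (relabel π u) ≤_) (cong (fireCount vs) (relabel-inverse π u))
             (fireCount-relabel-≤ (flip ∘ π) (relabel π u)))
      (fireCount-relabel-≤ π u)

    terminal-relabel : ∀ π u → τ (relabel π u) ≡ τ u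
    terminal-relabel π u = +-cancelʳ-≡ (f u * suc k) _ _ (begin
        τ (relabel π u) + f u * suc k                        ≡⟨ cong (λ x → τ (relabel π u) + x * suc k) (fireCount-relabel π u) ⟨
        τ (relabel π u) + f (relabel π u) * suc k            ≡⟨ conservation fires (relabel π u) ⟩
        initial k N (relabel π u) + inflow f (relabel π u)   ≡⟨ cong₂ _+_ (initial-relabel N π u) (sym (inflow-relabel π f u)) ⟩
        initial k N u + inflow (f ∘ relabel π) u             ≡⟨ cong (initial k N u +_) (inflow-cong (fireCount-relabel π) u) ⟩
        initial k N u + inflow f u                           ≡⟨ conservation fires u ⟨
        τ u + f u * suc k                                    ∎)
      where
      open ≡-Reasoning
      f : Vertex k → ℕ
      f = fireCount vs

module Layers {k N : ℕ} {{_ : NonZero k}} {vs : List (Vertex k)} {τ : Config k}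
              (fires : Fires k (initial k N) vs τ) (stable : Stable k τ) (z : Fin k) where

  layer : ℕ → Vertex k
  layer d = replicate d z

  F C : ℕ → ℕ
  F d = fireCount vs (layer d)
  C d = τ (layer d)

  fireCount-layered : ∀ u → fireCount vs u ≡ F (length u)
  fireCount-layered = relabel-invariant⇒layered (fireCount vs) z (fireCount-relabel fires stable)

  terminal-layered : ∀ u → τ u ≡ C (length u)
  terminal-layered = relabel-invariant⇒layered τ z (terminal-relabel fires stable)

  C≤k : ∀ d → C d ≤ k
  C≤k d = ≤-pred (stable (layer d))

  depthBound : ℕ
  depthBound = suc (listSum (map length vs))

  F-finite : ∀ d → depthBound ≤ d → F d ≡ 0
  F-finite d deep = fireCount-deep vs (layer d) (≤-trans deep (≤-reflexive (sym (length-replicate d))))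

  vertex-balance : ∀ u → C (length u) + F (length u) * suc k ≡
                         initial k N u + (F (length u ∸ 1) + k * F (suc (length u)))
  vertex-balance u = begin
      C (length u) + F (length u) * suc k
    ≡⟨ cong₂ (λ x y → x + y * suc k) (terminal-layered u) (fireCount-layered u) ⟨
      τ u + fireCount vs u * suc k
    ≡⟨ conservation fires u ⟩
      initial k N u + inflow (fireCount vs) u
    ≡⟨ cong (initial k N u +_) (trans (inflow-cong fireCount-layered u) (inflow-layered F u)) ⟩
      initial k N u + (F (length u ∸ 1) + k * F (suc (length u)))
    ∎
    where open ≡-Reasoning

  balance : ∀ d → C d + F d * suc k ≡ initial k N (layer d) + (F (d ∸ 1) + k * F (suc d))
  balance d = subst (λ x → C x + F x * suc k ≡ initial k N (layer d) + (F (x ∸ 1) + k * F (suc x)))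
                    (length-replicate d) (vertex-balance (layer d))

  layer-unfiring : ∀ (E : ℕ → ℕ) → (∀ d → E d ≤ F d) →
                   (∀ d → C d + E d * suc k ≤ k + (E (d ∸ 1) + k * E (suc d))) → ∀ d → E d ≡ 0
  layer-unfiring E E≤F unfired d =
    subst (λ x → E x ≡ 0) (length-replicate d) (stable-unfiring⇒zero fires E≤f unfired′ (layer d))
    where
    E≤f : ∀ u → E (length u) ≤ fireCount vs u
    E≤f u = subst (E (length u) ≤_) (sym (fireCount-layered u)) (E≤F (length u))
    unfired′ : ∀ u → τ u + E (length u) * suc k ≤ k + inflow (E ∘ length) u
    unfired′ u rewrite terminal-layered u | inflow-layered E u = unfired (length u)

  F-antitone-suc : ∀ d → F (suc d) ≤ F d
  F-antitone-suc d = descend depthBound d (m≤n+m depthBound d)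
    where
    antitone-step : ∀ d → F (suc (suc d)) ≤ F (suc d) → F (suc d) ≤ F d
    antitone-step d le = +-cancelʳ-≤ (k * F (suc d)) _ _ (begin
        F (suc d) + k * F (suc d)       ≡⟨ trans (*-suc (F (suc d)) k) (cong (F (suc d) +_) (*-comm _ k)) ⟨
        F (suc d) * suc k               ≤⟨ m≤n+m _ (C (suc d)) ⟩
        C (suc d) + F (suc d) * suc k   ≡⟨ balance (suc d) ⟩
        F d + k * F (suc (suc d))       ≤⟨ +-monoʳ-≤ (F d) (*-monoʳ-≤ k le) ⟩
        F d + k * F (suc d)             ∎)
      where open ≤-Reasoning
    descend : ∀ t d → depthBound ≤ d + t → F (suc d) ≤ F d
    descend zero    d deep = subst (_≤ F d) (sym (F-finite (suc d) deep′)) z≤n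
      where
      deep′ : depthBound ≤ suc d
      deep′ = m≤n⇒m≤1+n (subst (depthBound ≤_) (+-identityʳ d) deep)
    descend (suc t) d deep = antitone-step d (descend t (suc d) (subst (depthBound ≤_) (+-suc d t) deep))

  F-antitone : ∀ {d e} → d ≤ e → F e ≤ F d
  F-antitone {d} {e} d≤e = subst (λ x → F x ≤ F d) (m∸n+n≡m d≤e) (F-antitone-+ (e ∸ d))
    where
    F-antitone-+ : ∀ t → F (t + d) ≤ F d
    F-antitone-+ zero    = ≤-refl
    F-antitone-+ (suc t) = ≤-trans (F-antitone-suc (t + d)) (F-antitone-+ t)

  F-pred-split : ∀ d → F d + (F (d ∸ 1) ∸ F d) ≡ F (d ∸ 1)
  F-pred-split d = m+[n∸m]≡n (F-antitone (m∸n≤m d 1))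

  -- Net number of chips a vertex at depth d receives across the edge to its parent,
  -- plus its initial chips: A 0 = N and A (suc d) = F d - F (suc d).
  A : ℕ → ℕ
  A d = initial k N (layer d) + (F (d ∸ 1) ∸ F d)

  A-root : A 0 ≡ N
  A-root = trans (cong (N +_) (n∸n≡0 (F 0))) (+-identityʳ N)

  A-rec : ∀ d → A d ≡ C d + k * A (suc d)
  A-rec d = net-flow k (C d) s p q (F (suc d)) (begin
      C d + (F (suc d) + q) * suc k          ≡⟨ cong (λ x → C d + x * suc k) (F-pred-split (suc d)) ⟩
      C d + F d * suc k                      ≡⟨ balance d ⟩
      s + (F (d ∸ 1) + k * F (suc d))        ≡⟨ cong (λ x → s + (x + k * F (suc d))) (F-pred-split d) ⟨
      s + (F d + p + k * F (suc d))          ≡⟨ cong (λ x → s + (x + p + k * F (suc d))) (F-pred-split (suc d)) ⟨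
      s + (F (suc d) + q + p + k * F (suc d)) ∎)
    where
    open ≡-Reasoning
    s p q : ℕ
    s = initial k N (layer d)
    p = F (d ∸ 1) ∸ F d
    q = F d ∸ F (suc d)

  A-finite : ∀ d → suc depthBound ≤ d → A d ≡ 0
  A-finite (suc d) (s≤s deep) = trans (cong (_∸ F (suc d)) (F-finite d deep)) (0∸n≡0 (F (suc d)))

  open Radix k A C A-rec (suc depthBound) A-finite

  -- Otherwise un-firing every layer 0, ..., j once would leave a stable configuration.
  empty-layer-silent : ∀ j → C j ≡ 0 → F j ≡ 0
  empty-layer-silent j Cj≡0 = n<1⇒n≡0 (≰⇒> λ Fj≥1 →
    contradiction (trans (sym (⟦⟧-yes (0 ≤? j) z≤n))
                         (layer-unfiring (λ d → ⟦ d ≤? j ⟧) (segment≤F Fj≥1) segment-unfired 0))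
                  λ ())
    where
    segment≤F : 1 ≤ F j → ∀ d → ⟦ d ≤? j ⟧ ≤ F d
    segment≤F Fj≥1 d = bound (d ≤? j)
      where
      bound : (d≤?j : Dec (d ≤ j)) → ⟦ d≤?j ⟧ ≤ F d
      bound (yes d≤j) = ≤-trans Fj≥1 (F-antitone d≤j)
      bound (no _)    = z≤n
    segment-unfired : ∀ d → C d + ⟦ d ≤? j ⟧ * suc k ≤ k + (⟦ d ∸ 1 ≤? j ⟧ + k * ⟦ suc d ≤? j ⟧)
    segment-unfired d with d ≤? j
    ... | no _ = ≤-trans (≤-reflexive (+-identityʳ (C d))) (≤-trans (C≤k d) (m≤m+n k _))
    ... | yes d≤j rewrite ⟦⟧-yes (d ∸ 1 ≤? j) (≤-trans (m∸n≤m d 1) d≤j) with suc d ≤? j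
    ...   | yes _  = ≤-trans (+-monoˡ-≤ (1 * suc k) (C≤k d)) (≤-reflexive (inner k))
      where
      inner : ∀ k → k + 1 * suc k ≡ k + (1 + k * 1)
      inner = solve-∀
    ...   | no d≮j = ≤-reflexive (trans (cong (_+ 1 * suc k) Cd≡0) (boundary k))
      where
      Cd≡0 : C d ≡ 0
      Cd≡0 = trans (cong C (≤-antisym d≤j (≤-pred (≰⇒> d≮j)))) Cj≡0
      boundary : ∀ k → 0 + 1 * suc k ≡ k + (1 + k * 0)
      boundary = solve-∀

  empty-layer-propagates : ∀ j → C j ≡ 0 → ∀ d → j ≤ d → C d ≡ 0
  empty-layer-propagates j Cj≡0 d j≤d with m≤n⇒m<n∨m≡n j≤d
  ... | inj₂ refl = Cj≡0
  ... | inj₁ (s≤s {n = d′} j≤d′) = m+n≡0⇒m≡0 (C (suc d′)) (begin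
      C (suc d′) + F (suc d′) * suc k  ≡⟨ balance (suc d′) ⟩
      F d′ + k * F (suc (suc d′))      ≡⟨ cong₂ (λ x y → x + k * y) (silent j≤d′) (silent (m≤n⇒m≤1+n (m≤n⇒m≤1+n j≤d′))) ⟩
      k * 0                            ≡⟨ *-zeroʳ k ⟩
      0                                ∎)
    where
    open ≡-Reasoning
    silent : ∀ {e} → j ≤ e → F e ≡ 0
    silent j≤e = n≤0⇒n≡0 (≤-trans (F-antitone j≤e) (≤-reflexive (empty-layer-silent j Cj≡0)))

  chips-vanish-from : ∀ n → N * (k ∸ 1) + 1 < k ^ suc n → ∀ m → n ≤ m → C m ≡ 0
  chips-vanish-from n N< m n≤m with C m ≟ 0
  ... | yes Cm≡0 = Cm≡0
  ... | no Cm≢0  = contradiction (begin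
      k ^ suc n          ≤⟨ ^-monoʳ-≤ k (s≤s n≤m) ⟩
      k ^ suc m          ≤⟨ power-≤ (suc m) 0 occupied ⟩
      A 0 * (k ∸ 1) + 1  ≡⟨ cong (λ x → x * (k ∸ 1) + 1) A-root ⟩
      N * (k ∸ 1) + 1    ∎) (<⇒≱ N<)
    where
    open ≤-Reasoning
    occupied : ∀ j → j < suc m → 1 ≤ C j
    occupied j j≤m = n≢0⇒n>0 (λ Cj≡0 → Cm≢0 (empty-layer-propagates j Cj≡0 m (≤-pred j≤m)))

  layer-difference : ∀ n → N * (k ∸ 1) + 1 < k ^ suc n →
                     ∀ i → F (suc i) + rangeSum (λ j → k ^ (j ∸ suc i) * C j) (suc i) (n ∸ suc i) ≡ F i
  layer-difference n N< i = begin
      F (suc i) + rangeSum (λ j → k ^ (j ∸ suc i) * C j) (suc i) (n ∸ suc i)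
    ≡⟨ cong (F (suc i) +_) (expansion (n ∸ suc i) (suc i) tail-empty) ⟨
      F (suc i) + A (suc i)
    ≡⟨ F-pred-split (suc i) ⟩
      F i
    ∎
    where
    open ≡-Reasoning
    tail-empty : ∀ j → suc i + (n ∸ suc i) ≤ j → C j ≡ 0
    tail-empty j le = chips-vanish-from n N< j (≤-trans (m≤n+m∸n n (suc i)) le)

mainTheorem3 : (k N n : ℕ) (h : 2 ≤ k) → 1 ≤ N →
    k ^ n ≤ N * (k ∸ 1) + 1 → N * (k ∸ 1) + 1 < k ^ suc n →
    (vs : List (Vertex k)) (σ : Config k) →
    Fires k (initial k N) vs σ → Stable k σ →
    (i : ℕ) →
    fireCount vs (layerVertex h (suc i)) + layerSum h σ i n
      ≡ fireCount vs (layerVertex h i)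
mainTheorem3 k N n h _ _ N<k^[n+1] vs σ fires stable i = layer-difference n N<k^[n+1] i
  where
  instance
    k≢0 : NonZero k
    k≢0 = >-nonZero (<⇒≤ h)
  open Layers fires stable (fin0 h)
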